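{- Let $\Sigma,\Gamma$ be finite alphabets, $n\in\mathbb N$, and let $w_0,w_1\in\mathsf{Point}\,\Sigma$ be pointed words with $w_0\sim_n w_1$. Then $p(w_0)\sim_n p(w_1)$ for every unary polynomial $p$ over the $\mathsf{Point}$-algebra $\mathsf{Point}\,\Sigma$, and $h(w_0)\sim_n h(w_1)$ for every $\mathsf{Point}$-morphism $h:\mathsf{Point}\,\Sigma\to\mathsf{Point}\,\Gamma$.
   Context: $\mathsf{Point}\,A = A^*\underline AA^*$ is the monad of pointed words (nonempty words with one distinguished position), with unit $a\mapsto\underline a$ and multiplication given by flattening (the distinguished position being that of the distinguished inner pointed word); $\mathsf{Point}\,\Sigma$ is the free $\mathsf{Point}$-algebra with this multiplication, and $\mathsf{Point}$-morphisms are Eilenberg–Moore homomorphisms. A unary polynomial over $\mathsf{Point}\,\Sigma$ is an element $p\in\mathsf{Point}(\mathsf{Point}\,\Sigma\sqcup\{x\})$; $p(w)$ is obtained by substituting $w$ for the variable $x$ and applying the multiplication. The relation $w_0\sim_n w_1$ holds if Duplicator has a winning strategy in the following $n$-round game: first, if the distinguished positions of $w_0,w_1$ have different labels, Spoiler wins. Otherwise, in each round Spoiler chooses $i\in\{0,1\}$ and a direction among left, stay, right, and moves the current selected position of $w_i$ accordingly (to some position strictly to the left, not at all, or strictly to the right); Duplicator must then move the selected position of $w_{1-i}$ in the same direction to a position with the same label as the new selected position of $w_i$, otherwise Spoiler wins. Duplicator wins if $n$ rounds are played without Spoiler winning. -}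

module Defs where

open import Data.List using (List; []; _∷_; _++_; concatMap; map)
open import Data.Product using (Σ; _×_; _,_; ∃)
open import Data.Sum using (_⊎_; inj₁; inj₂)
open import Data.Unit using (⊤; tt)
open import Data.Nat using (ℕ; zero; suc)
open import Relation.Binary.PropositionalEquality using (_≡_)

-- Pointed word A* A̲ A*: left part, distinguished letter, right part.
record Point (A : Set) : Set where
  constructor ⟨_,_,_⟩
  field
    left  : List A
    mid   : A
    right : List A
open Point public

word : {A : Set} → Point A → List A
word ⟨ l , a , r ⟩ = l ++ (a ∷ r)

mapP : {A B : Set} → (A → B) → Point A → Point B
mapP f ⟨ l , a , r ⟩ = ⟨ map f l , f a , map f r ⟩

ηP : {A : Set} → A → Point A
ηP a = ⟨ [] , a , [] ⟩

μP : {A : Set} → Point (Point A) → Point A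
μP ⟨ L , ⟨ l , a , r ⟩ , R ⟩ = ⟨ concatMap word L ++ l , a , r ++ concatMap word R ⟩

-- Unary polynomials over the free Point-algebra Point Σ: elements of
-- Point (Point Σ ⊔ {x}); the variable x is inj₂ tt.
UnaryPoly : Set → Set
UnaryPoly S = Point (Point S ⊎ ⊤)

subst-x : {S : Set} → Point S → Point S ⊎ ⊤ → Point S
subst-x w (inj₁ v)  = v
subst-x w (inj₂ tt) = w

evalPoly : {S : Set} → UnaryPoly S → Point S → Point S
evalPoly p w = μP (mapP (subst-x w) p)

-- Eilenberg–Moore homomorphisms between free Point-algebras
record PointMorphism (S G : Set) : Set where
  field
    fun     : Point S → Point G
    preserv : ∀ (W : Point (Point S)) → fun (μP W) ≡ μP (mapP fun W)
open PointMorphism public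

data Dir : Set where
  leftD stayD rightD : Dir

data Move {A : Set} : Dir → Point A → Point A → Set where
  mvLeft  : ∀ l₁ b l₂ a r →
            Move leftD ⟨ l₁ ++ (b ∷ l₂) , a , r ⟩ ⟨ l₁ , b , l₂ ++ (a ∷ r) ⟩
  mvStay  : ∀ w → Move stayD w w
  mvRight : ∀ l a r₁ b r₂ →
            Move rightD ⟨ l , a , r₁ ++ (b ∷ r₂) ⟩ ⟨ l ++ (a ∷ r₁) , b , r₂ ⟩

-- Duplicator survives n more rounds from the configuration (u , v)
-- (labels of the current selected positions are assumed already equal).
DupWins : {A : Set} → ℕ → Point A → Point A → Set
DupWins zero    u v = ⊤
DupWins (suc n) u v =
  (∀ d u' → Move d u u' → ∃ λ v' → Move d v v' × mid u' ≡ mid v' × DupWins n u' v')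
  × (∀ d v' → Move d v v' → ∃ λ u' → Move d u u' × mid u' ≡ mid v' × DupWins n u' v')

_∼[_]_ : {A : Set} → Point A → ℕ → Point A → Set
w₀ ∼[ n ] w₁ = (mid w₀ ≡ mid w₁) × DupWins n w₀ w₁

module Submission where

-- Both halves of the theorem are instances of one composition principle.
-- Given a substitution g : B → Point A, a pointed word U over B and a pointing
-- v of the block g (mid U), let  expand g U v  be the flattened word
-- g(U) pointed at position v inside the distinguished block.  The
-- composition theorem says: if U₀ ∼ₘ U₁, v₀ ∼ₘ v₁, and below level m every
-- pointing of a block g₀ b can be matched by a pointing of g₁ b (and vice
-- versa), then expand g₀ U₀ v₀ ∼ₘ expand g₁ U₁ v₁.  Duplicator plays the
-- inner game while Spoiler stays inside the current block, and the outer
-- game as soon as Spoiler leaves it.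
--   * p(w) is an expansion of the polynomial p itself (outer words equal,
--     the x-blocks differ, and w₀ ∼ₙ w₁ gives the block matching);
--   * h(w) is an expansion of w along a ↦ h(a̲) (outer words w₀ ∼ₙ w₁,
--     blocks equal), because h commutes with flattening.

open import Defs
open import Data.Nat using (ℕ; zero; suc; _≤_; _<_; s≤s)
open import Data.Nat.Properties using (≤-refl; n≤1+n; m≤n⇒m≤1+n)
open import Data.Fin using (Fin)
open import Data.Product using (_×_; _,_; ∃; proj₁; proj₂; swap)
open import Data.Sum using (_⊎_; inj₁; inj₂)
open import Data.Unit using (⊤; tt)
open import Data.List using (List; []; _∷_; _++_; [_]; concatMap; map)
open import Data.List.Properties
  using (++-assoc; ++-identityʳ; ++-cancelˡ; ++-cancelʳ; ∷-injective; ∷ʳ-injective; map-∘; ++-monoid)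
open import Function using (_∘_)
open import Relation.Binary.PropositionalEquality
  using (_≡_; refl; sym; trans; cong; cong₂; subst; subst₂; module ≡-Reasoning)
import Algebra.Solver.Monoid as MonoidSolver

private variable
  A B : Set
  d : Dir
  k m n : ℕ
  u v w x y : Point A

-- Reassociation identities for list concatenation, discharged by the monoid
-- solver; a letter a enters as the singleton [ a ], since [ a ] ++ r = a ∷ r.
module Reassoc {A : Set} where
  open MonoidSolver (++-monoid A)

  jump-left : (P Q l l' r' : List A) (a : A) →
    (P ++ ((l' ++ a ∷ r') ++ Q)) ++ l ≡ (P ++ l') ++ a ∷ (r' ++ (Q ++ l))
  jump-left P Q l l' r' a =
    solve 6 (λ P Q l l' r' a → (P ⊕ ((l' ⊕ (a ⊕ r')) ⊕ Q)) ⊕ l ⊜ (P ⊕ l') ⊕ (a ⊕ (r' ⊕ (Q ⊕ l))))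
      refl P Q l l' r' [ a ]

  jump-right : (Q S r l' r' : List A) (a : A) →
    r ++ (Q ++ ((l' ++ a ∷ r') ++ S)) ≡ (r ++ (Q ++ l')) ++ a ∷ (r' ++ S)
  jump-right Q S r l' r' a =
    solve 6 (λ Q S r l' r' a → r ⊕ (Q ⊕ ((l' ⊕ (a ⊕ r')) ⊕ S)) ⊜ (r ⊕ (Q ⊕ l')) ⊕ (a ⊕ (r' ⊕ S)))
      refl Q S r l' r' [ a ]

  frame-word : (P S l r : List A) (a : A) →
    (P ++ l) ++ a ∷ (r ++ S) ≡ P ++ ((l ++ a ∷ r) ++ S)
  frame-word P S l r a =
    solve 5 (λ P S l r a → (P ⊕ l) ⊕ (a ⊕ (r ⊕ S)) ⊜ P ⊕ ((l ⊕ (a ⊕ r)) ⊕ S)) refl P S l r [ a ]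

open Reassoc

++-split : (l₁ : List A) (c : A) (l₂ X Y : List A) → l₁ ++ c ∷ l₂ ≡ X ++ Y →
  (∃ λ Y₁ → l₁ ≡ X ++ Y₁ × Y ≡ Y₁ ++ c ∷ l₂) ⊎ (∃ λ X₂ → X ≡ l₁ ++ c ∷ X₂ × l₂ ≡ X₂ ++ Y)
++-split l₁ c l₂ [] Y e = inj₁ (l₁ , refl , sym e)
++-split [] c l₂ (x ∷ X) Y e with ∷-injective e
... | refl , e' = inj₂ (X , refl , e')
++-split (a ∷ l₁) c l₂ (x ∷ X) Y e with ∷-injective e
... | refl , e' with ++-split l₁ c l₂ X Y e'
...   | inj₁ (Y₁ , p , q) = inj₁ (Y₁ , cong (a ∷_) p , q)
...   | inj₂ (X₂ , p , q) = inj₂ (X₂ , cong (a ∷_) p , q)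

determined-by-left : word y ≡ word x → left y ≡ left x → y ≡ x
determined-by-left {y = ⟨ l , a , r ⟩} {x = ⟨ _ , a' , r' ⟩} e refl
  with ∷-injective (++-cancelˡ l (a ∷ r) (a' ∷ r') e)
... | refl , refl = refl

determined-by-right : word y ≡ word x → right y ≡ right x → y ≡ x
determined-by-right {y = ⟨ l , a , r ⟩} {x = ⟨ l' , a' , _ ⟩} e refl
  with ∷ʳ-injective l l' (++-cancelʳ r (l ++ [ a ]) (l' ++ [ a' ])
         (trans (++-assoc l [ a ] r) (trans e (sym (++-assoc l' [ a' ] r)))))
... | refl , refl = refl

move-word : Move d x y → word x ≡ word y
move-word (mvLeft l₁ c l₂ a r)  = ++-assoc l₁ (c ∷ l₂) (a ∷ r)
move-word (mvStay w)            = refl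
move-word (mvRight l a r₁ c r₂) = sym (++-assoc l (a ∷ r₁) (c ∷ r₂))

same-landing-left : Move d x y → Move d x w → left y ≡ left w → y ≡ w
same-landing-left my mw = determined-by-left (trans (sym (move-word my)) (move-word mw))

same-landing-right : Move d x y → Move d x w → right y ≡ right w → y ≡ w
same-landing-right my mw = determined-by-right (trans (sym (move-word my)) (move-word mw))

stay-view : Move stayD x y → x ≡ y
stay-view (mvStay _) = refl

left-view : Move leftD x y → ∃ λ l₂ → left x ≡ left y ++ mid y ∷ l₂
left-view (mvLeft _ _ l₂ _ _) = l₂ , refl

right-view : Move rightD x y → ∃ λ r₁ → right x ≡ r₁ ++ mid y ∷ right y
right-view (mvRight _ _ r₁ _ _) = r₁ , refl

move-left : (x : Point A) {l₁ : List A} {c : A} {l₂ : List A} → left x ≡ l₁ ++ c ∷ l₂ →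
  Move leftD x ⟨ l₁ , c , l₂ ++ mid x ∷ right x ⟩
move-left ⟨ _ , a , r ⟩ refl = mvLeft _ _ _ a r

move-right : (x : Point A) {r₁ : List A} {c : A} {r₂ : List A} → right x ≡ r₁ ++ c ∷ r₂ →
  Move rightD x ⟨ left x ++ mid x ∷ r₁ , c , r₂ ⟩
move-right ⟨ l , a , _ ⟩ refl = mvRight l a _ _ _

move-left-to : (x : Point A) {y : Point A} {l₂ : List A} →
  left x ≡ left y ++ mid y ∷ l₂ → word y ≡ word x → Move leftD x y
move-left-to x el e =
  subst (Move leftD x) (determined-by-left (trans (sym (move-word (move-left x el))) (sym e)) refl) (move-left x el)

move-right-to : (x : Point A) {y : Point A} {r₁ : List A} →
  right x ≡ r₁ ++ mid y ∷ right y → word y ≡ word x → Move rightD x y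
move-right-to x er e =
  subst (Move rightD x) (determined-by-right (trans (sym (move-word (move-right x er))) (sym e)) refl) (move-right x er)

reach : (w v : Point A) → word v ≡ word w → ∃ λ d → Move d w v
reach w v e with ++-split (left v) (mid v) (right v) (left w) (mid w ∷ right w) e
... | inj₁ ([] , el , _) =
  stayD , subst (Move stayD w) (determined-by-left (sym e) (sym (trans el (++-identityʳ (left w))))) (mvStay w)
... | inj₁ (c ∷ Y , _ , er) with ∷-injective er
...   | refl , er' = rightD , move-right-to w er' e
reach w v e | inj₂ (X₂ , el , _) = leftD , move-left-to w el e

dup-sym : DupWins n u v → DupWins n v u
dup-sym {n = zero}  _ = tt
dup-sym {n = suc n} (fwd , bwd) =
  (λ d v' mv → let (u' , mu , e , W) = bwd d v' mv in u' , mu , sym e , dup-sym W) ,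
  (λ d u' mu → let (v' , mv , e , W) = fwd d u' mu in v' , mv , sym e , dup-sym W)

dup-refl : DupWins n u u
dup-refl {n = zero}  = tt
dup-refl {n = suc n} =
  (λ d u' mu → u' , mu , refl , dup-refl) , (λ d u' mu → u' , mu , refl , dup-refl)

dup-mono : k ≤ n → DupWins n u v → DupWins k u v
dup-mono {k = zero}  _ _ = tt
dup-mono {k = suc k} (s≤s k≤n) (fwd , bwd) =
  (λ d u' mu → let (v' , mv , e , W) = fwd d u' mu in v' , mv , e , dup-mono k≤n W) ,
  (λ d v' mv → let (u' , mu , e , W) = bwd d v' mv in u' , mu , e , dup-mono k≤n W)

∼-sym : u ∼[ n ] v → v ∼[ n ] u
∼-sym (e , W) = sym e , dup-sym W

∼-refl : u ∼[ n ] u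
∼-refl = refl , dup-refl

∼-mono : u ∼[ suc n ] v → u ∼[ n ] v
∼-mono {n = n} (e , W) = e , dup-mono (n≤1+n n) W

Answers : ℕ → Point A → Point A → Set
Answers m u v = ∀ d u' → Move d u u' → ∃ λ v' → Move d v v' × mid u' ≡ mid v' × DupWins m u' v'

dup-intro : Answers m u v → Answers m v u → DupWins (suc m) u v
dup-intro fwd bwd = fwd , λ d v' mv → let (u' , mu , e , W) = bwd d v' mv in u' , mu , sym e , dup-sym W

Mimics : ℕ → Point A → Point A → Set
Mimics k u₀ u₁ = ∀ v₀ → word v₀ ≡ word u₀ → ∃ λ v₁ → word v₁ ≡ word u₁ × v₀ ∼[ k ] v₁

mimics-refl : Mimics k u u
mimics-refl v₀ e = v₀ , e , ∼-refl

-- Spoiler's first move can reach any repointing of w₀ (reach), so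
-- w₀ ∼ₙ w₁ lets every repointing be mimicked at every level below n.
∼⇒mimics : w ∼[ n ] x → k < n → Mimics k w x
∼⇒mimics {w = w} (_ , fwd , _) (s≤s k≤n) v₀ e =
  let (d , mv₀) = reach w v₀ e
      (v₁ , mv₁ , em , W) = fwd d v₀ mv₀
  in v₁ , sym (move-word mv₁) , em , dup-mono k≤n W

blocks : (B → Point A) → List B → List A
blocks g L = concatMap word (map g L)

blocks-++ : (g : B → Point A) (L M : List B) → blocks g (L ++ M) ≡ blocks g L ++ blocks g M
blocks-++ g []      M = refl
blocks-++ g (b ∷ L) M =
  trans (cong (word (g b) ++_) (blocks-++ g L M)) (sym (++-assoc (word (g b)) (blocks g L) (blocks g M)))

-- The expansion of U along g, pointed at v inside the block of the
-- distinguished letter of U; this is how μP computes flattenings.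
expand : (B → Point A) → Point B → Point A → Point A
expand g U v = ⟨ blocks g (left U) ++ left v , mid v , right v ++ blocks g (right U) ⟩

InBlock : (B → Point A) → Point B → Point A → Set
InBlock g U v = word v ≡ word (g (mid U))

word-expand : (g : B → Point A) (U : Point B) {v : Point A} → InBlock g U v →
  word (expand g U v) ≡ blocks g (word U)
word-expand g U {v} wv = begin
  (blocks g (left U) ++ left v) ++ mid v ∷ (right v ++ blocks g (right U))
    ≡⟨ frame-word (blocks g (left U)) (blocks g (right U)) (left v) (right v) (mid v) ⟩
  blocks g (left U) ++ (word v ++ blocks g (right U))
    ≡⟨ cong (λ z → blocks g (left U) ++ (z ++ blocks g (right U))) wv ⟩
  blocks g (left U) ++ blocks g (mid U ∷ right U)
    ≡⟨ sym (blocks-++ g (left U) (mid U ∷ right U)) ⟩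
  blocks g (word U) ∎
  where open ≡-Reasoning

record BlockSplit {A B : Set} (g : B → Point A) (L : List B) (l₁ : List A) (c : A) (l₂ : List A) : Set where
  constructor split-at
  field
    L₁ : List B
    b  : B
    L₂ : List B
    p q : List A
    L-split     : L ≡ L₁ ++ b ∷ L₂
    block-split : word (g b) ≡ p ++ c ∷ q
    l₁-split    : l₁ ≡ blocks g L₁ ++ p
    l₂-split    : l₂ ≡ q ++ blocks g L₂

blocks-split : (g : B → Point A) (L : List B) (l₁ : List A) (c : A) (l₂ : List A) →
  l₁ ++ c ∷ l₂ ≡ blocks g L → BlockSplit g L l₁ c l₂
blocks-split g []      []      c l₂ ()
blocks-split g []      (_ ∷ _) c l₂ ()
blocks-split g (b ∷ L) l₁ c l₂ e with ++-split l₁ c l₂ (word (g b)) (blocks g L) e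
... | inj₂ (q , eb , el₂) = split-at [] b L l₁ q refl eb refl el₂
... | inj₁ (Y , el₁ , eY) with blocks-split g L Y c l₂ (sym eY)
...   | split-at L₁ b' L₂ p q eL eb eY₁ el₂ =
  split-at (b ∷ L₁) b' L₂ p q (cong (b ∷_) eL) eb
    (trans el₁ (trans (cong (word (g b) ++_) eY₁) (sym (++-assoc (word (g b)) (blocks g L₁) p)))) el₂

expand-inner : (g : B → Point A) (U : Point B) {v v' : Point A} → Move d v v' →
  Move d (expand g U v) (expand g U v')
expand-inner g U (mvStay _) = mvStay _
expand-inner g U (mvLeft l₁ c l₂ a r) =
  subst (Move leftD _) (cong (λ z → ⟨ blocks g (left U) ++ l₁ , c , z ⟩) (sym (++-assoc l₂ (a ∷ r) S)))
    (move-left (expand g U ⟨ l₁ ++ c ∷ l₂ , a , r ⟩) (sym (++-assoc (blocks g (left U)) l₁ (c ∷ l₂))))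
  where S = blocks g (right U)
expand-inner g U (mvRight l a r₁ c r₂) =
  subst (Move rightD _) (cong (λ z → ⟨ z , c , r₂ ++ blocks g (right U) ⟩) (++-assoc P l (a ∷ r₁)))
    (move-right (expand g U ⟨ l , a , r₁ ++ c ∷ r₂ ⟩) (++-assoc r₁ (c ∷ r₂) (blocks g (right U))))
  where P = blocks g (left U)

data NotStay : Dir → Set where
  left-move  : NotStay leftD
  right-move : NotStay rightD

expand-same-word : (g : B → Point A) {U U' : Point B} {v v' : Point A} →
  InBlock g U v → InBlock g U' v' → word U' ≡ word U → word (expand g U' v') ≡ word (expand g U v)
expand-same-word g {U} {U'} {v} {v'} wv wv' eU = begin
  word (expand g U' v') ≡⟨ word-expand g U' wv' ⟩
  blocks g (word U')    ≡⟨ cong (blocks g) eU ⟩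
  blocks g (word U)     ≡⟨ sym (word-expand g U wv) ⟩
  word (expand g U v)   ∎
  where open ≡-Reasoning

blocks-around : (g : B → Point A) (L₁ : List B) {b : B} (L₂ : List B) {v : Point A} →
  word v ≡ word (g b) → blocks g (L₁ ++ b ∷ L₂) ≡ blocks g L₁ ++ (word v ++ blocks g L₂)
blocks-around g L₁ L₂ wv =
  trans (blocks-++ g L₁ (_ ∷ L₂)) (cong (λ z → blocks g L₁ ++ (z ++ blocks g L₂)) (sym wv))

expand-outer : (g : B → Point A) {U U' : Point B} {v v' : Point A} → NotStay d →
  InBlock g U v → Move d U U' → InBlock g U' v' → Move d (expand g U v) (expand g U' v')
expand-outer g {U} {U'} {v} {v'} left-move wv mU wv' with left-view mU
... | L₂ , eL = move-left-to (expand g U v) left-part (expand-same-word g wv wv' (sym (move-word mU)))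
  where
  open ≡-Reasoning
  left-part : blocks g (left U) ++ left v ≡
    (blocks g (left U') ++ left v') ++ mid v' ∷ (right v' ++ (blocks g L₂ ++ left v))
  left-part = begin
    blocks g (left U) ++ left v
      ≡⟨ cong (λ L → blocks g L ++ left v) eL ⟩
    blocks g (left U' ++ mid U' ∷ L₂) ++ left v
      ≡⟨ cong (_++ left v) (blocks-around g (left U') L₂ wv') ⟩
    (blocks g (left U') ++ ((left v' ++ mid v' ∷ right v') ++ blocks g L₂)) ++ left v
      ≡⟨ jump-left (blocks g (left U')) (blocks g L₂) (left v) (left v') (right v') (mid v') ⟩
    (blocks g (left U') ++ left v') ++ mid v' ∷ (right v' ++ (blocks g L₂ ++ left v)) ∎
expand-outer g {U} {U'} {v} {v'} right-move wv mU wv' with right-view mU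
... | R₁ , eR = move-right-to (expand g U v) right-part (expand-same-word g wv wv' (sym (move-word mU)))
  where
  open ≡-Reasoning
  right-part : right v ++ blocks g (right U) ≡
    (right v ++ (blocks g R₁ ++ left v')) ++ mid v' ∷ (right v' ++ blocks g (right U'))
  right-part = begin
    right v ++ blocks g (right U)
      ≡⟨ cong (λ R → right v ++ blocks g R) eR ⟩
    right v ++ blocks g (R₁ ++ mid U' ∷ right U')
      ≡⟨ cong (right v ++_) (blocks-around g R₁ (right U') wv') ⟩
    right v ++ (blocks g R₁ ++ ((left v' ++ mid v' ∷ right v') ++ blocks g (right U')))
      ≡⟨ jump-right (blocks g R₁) (blocks g (right U')) (right v) (left v') (right v') (mid v') ⟩
    (right v ++ (blocks g R₁ ++ left v')) ++ mid v' ∷ (right v' ++ blocks g (right U')) ∎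

data ExpandMove {A B : Set} (g : B → Point A) (d : Dir) (U : Point B) (v y : Point A) : Set where
  inner : {v' : Point A} → Move d v v' → y ≡ expand g U v' → ExpandMove g d U v y
  outer : {U' : Point B} {v' : Point A} → NotStay d → Move d U U' → InBlock g U' v' →
          y ≡ expand g U' v' → ExpandMove g d U v y

-- Every move of an expansion is of one of these two kinds: locate the new
-- position in the left (right) part, and if it is outside the current
-- block, locate its block.
decompose : (g : B → Point A) (U : Point B) {v : Point A} → InBlock g U v →
  Move d (expand g U v) y → ExpandMove g d U v y
decompose {d = stayD} g U wv mv = inner (mvStay _) (sym (stay-view mv))
decompose {d = leftD} {y = y} g U {v} wv mv with left-view mv
... | l₂ , e with ++-split (left y) (mid y) l₂ (blocks g (left U)) (left v) (sym e)
...   | inj₁ (_ , ey , ev) = inner (move-left v ev) (same-landing-left mv (expand-inner g U (move-left v ev)) ey)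
...   | inj₂ (_ , eb , _) with blocks-split g (left U) (left y) (mid y) _ (sym eb)
...     | split-at _ _ _ _ _ eL ew ey _ =
  outer left-move (move-left U eL) (sym ew)
    (same-landing-left mv (expand-outer g left-move wv (move-left U eL) (sym ew)) ey)
decompose {d = rightD} {y = y} g U {v} wv mv with right-view mv
... | r₁ , e with ++-split r₁ (mid y) (right y) (right v) (blocks g (right U)) (sym e)
...   | inj₂ (_ , ev , ey) = inner (move-right v ev) (same-landing-right mv (expand-inner g U (move-right v ev)) ey)
...   | inj₁ (Y , _ , eb) with blocks-split g (right U) Y (mid y) (right y) (sym eb)
...     | split-at _ _ _ _ _ eR ew _ ey =
  outer right-move (move-right U eR) (sym ew)
    (same-landing-right mv (expand-outer g right-move wv (move-right U eR) (sym ew)) ey)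

BlocksMatch : ℕ → (B → Point A) → (B → Point A) → Set
BlocksMatch k g₀ g₁ = ∀ b → Mimics k (g₀ b) (g₁ b) × Mimics k (g₁ b) (g₀ b)

-- Duplicator answers inner moves by the inner game and outer moves by
-- the outer game, choosing the new inner pointing by block matching.
mutual
  compose : (m : ℕ) {g₀ g₁ : B → Point A} → (∀ {k} → k < m → BlocksMatch k g₀ g₁) →
    {U₀ U₁ : Point B} {v₀ v₁ : Point A} → InBlock g₀ U₀ v₀ → InBlock g₁ U₁ v₁ →
    U₀ ∼[ m ] U₁ → v₀ ∼[ m ] v₁ → expand g₀ U₀ v₀ ∼[ m ] expand g₁ U₁ v₁
  compose zero    match i₀ i₁ U∼ v∼ = proj₁ v∼ , tt
  compose (suc m) match i₀ i₁ U∼ v∼ =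
    proj₁ v∼ ,
    dup-intro (answer m match i₀ i₁ U∼ v∼)
              (answer m (λ k<m b → swap (match k<m b)) i₁ i₀ (∼-sym U∼) (∼-sym v∼))

  answer : (m : ℕ) {g₀ g₁ : B → Point A} → (∀ {k} → k < suc m → BlocksMatch k g₀ g₁) →
    {U₀ U₁ : Point B} {v₀ v₁ : Point A} → InBlock g₀ U₀ v₀ → InBlock g₁ U₁ v₁ →
    U₀ ∼[ suc m ] U₁ → v₀ ∼[ suc m ] v₁ → Answers m (expand g₀ U₀ v₀) (expand g₁ U₁ v₁)
  answer m {g₀} {g₁} match {U₀} {U₁} i₀ i₁ U∼ (_ , inner-fwd , _) d y mv with decompose g₀ U₀ i₀ mv
  ... | inner {v₀'} mv₀ refl =
    let (v₁' , mv₁ , em , W) = inner-fwd d v₀' mv₀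
    in expand g₁ U₁ v₁' , expand-inner g₁ U₁ mv₁ , em ,
       proj₂ (compose m (match ∘ m≤n⇒m≤1+n) (trans (sym (move-word mv₀)) i₀) (trans (sym (move-word mv₁)) i₁)
                      (∼-mono U∼) (em , W))
  ... | outer {U₀'} {v₀'} ns mU₀ i₀' refl =
    let (_ , outer-fwd , _) = U∼
        (U₁' , mU₁ , emU , WU) = outer-fwd d U₀' mU₀
        (v₁' , i₁' , v∼') = proj₁ (match ≤-refl (mid U₀')) v₀' i₀'
        i₁'' : InBlock g₁ U₁' v₁'
        i₁'' = trans i₁' (cong (word ∘ g₁) emU)
    in expand g₁ U₁' v₁' , expand-outer g₁ ns i₁ mU₁ i₁'' , proj₁ v∼' ,
       proj₂ (compose m (match ∘ m≤n⇒m≤1+n) i₀' i₁'' (emU , WU) v∼')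

evalPoly-expand : (p : UnaryPoly A) (w : Point A) → evalPoly p w ≡ expand (subst-x w) p (subst-x w (mid p))
evalPoly-expand p w = refl

subst-x-blocks-match : {w₀ w₁ : Point A} → w₀ ∼[ n ] w₁ → k < n →
  BlocksMatch k (subst-x w₀) (subst-x w₁)
subst-x-blocks-match H k<n (inj₁ c)  = mimics-refl , mimics-refl
subst-x-blocks-match H k<n (inj₂ tt) = ∼⇒mimics H k<n , ∼⇒mimics (∼-sym H) k<n

subst-x-∼ : {w₀ w₁ : Point A} → w₀ ∼[ n ] w₁ → (b : Point A ⊎ ⊤) → subst-x w₀ b ∼[ n ] subst-x w₁ b
subst-x-∼ H (inj₁ c)  = ∼-refl
subst-x-∼ H (inj₂ tt) = H

blocks-η : (l : List A) → blocks ηP l ≡ l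
blocks-η []      = refl
blocks-η (a ∷ l) = cong (a ∷_) (blocks-η l)

μP-mapP-ηP : (w : Point A) → μP (mapP ηP w) ≡ w
μP-mapP-ηP ⟨ l , a , r ⟩ = cong₂ (λ l' r' → ⟨ l' , a , r' ⟩) (trans (++-identityʳ _) (blocks-η l)) (blocks-η r)

mapP-∘ : {C : Set} (f : B → C) (g : A → B) (w : Point A) → mapP f (mapP g w) ≡ mapP (f ∘ g) w
mapP-∘ f g ⟨ l , a , r ⟩ = cong₂ (λ l' r' → ⟨ l' , f (g a) , r' ⟩) (sym (map-∘ l)) (sym (map-∘ r))

-- A Point-morphism h maps w to the expansion of w along a ↦ h(a̲), since
-- w = μP (mapP ηP w) and h commutes with μP.
morphism-expand : {S G : Set} (h : PointMorphism S G) (w : Point S) →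
  fun h w ≡ expand (fun h ∘ ηP) w (fun h (ηP (mid w)))
morphism-expand h w = begin
  fun h w                        ≡⟨ cong (fun h) (sym (μP-mapP-ηP w)) ⟩
  fun h (μP (mapP ηP w))         ≡⟨ preserv h (mapP ηP w) ⟩
  μP (mapP (fun h) (mapP ηP w))  ≡⟨ cong μP (mapP-∘ (fun h) ηP w) ⟩
  μP (mapP (fun h ∘ ηP) w)       ∎
  where open ≡-Reasoning

blocks-match-refl : {g : B → Point A} → BlocksMatch k g g
blocks-match-refl b = mimics-refl , mimics-refl

mainTheorem11 : (s g n : ℕ) (w₀ w₁ : Point (Fin s)) → w₀ ∼[ n ] w₁ →
    ((p : UnaryPoly (Fin s)) → evalPoly p w₀ ∼[ n ] evalPoly p w₁)
    × ((h : PointMorphism (Fin s) (Fin g)) → fun h w₀ ∼[ n ] fun h w₁)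
mainTheorem11 s g n w₀ w₁ H = polynomials , morphisms
  where
  polynomials : (p : UnaryPoly (Fin s)) → evalPoly p w₀ ∼[ n ] evalPoly p w₁
  polynomials p =
    subst₂ (_∼[ n ]_) (sym (evalPoly-expand p w₀)) (sym (evalPoly-expand p w₁))
      (compose n (subst-x-blocks-match H) refl refl (∼-refl {u = p}) (subst-x-∼ H (mid p)))

  morphisms : (h : PointMorphism (Fin s) (Fin g)) → fun h w₀ ∼[ n ] fun h w₁
  morphisms h =
    subst₂ (_∼[ n ]_) (sym (morphism-expand h w₀)) (sym (morphism-expand h w₁))
      (compose n (λ _ → blocks-match-refl) refl refl H same-letter-blocks)
    where
    same-letter-blocks : fun h (ηP (mid w₀)) ∼[ n ] fun h (ηP (mid w₁))
    same-letter-blocks = subst (λ a → fun h (ηP (mid w₀)) ∼[ n ] fun h (ηP a)) (proj₁ H) ∼-refl
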